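{- $SL_2(\mathbb{N}) \cap \tilde{\beta}^{ -1}(SL_2(\mathbb{N})) = \Sigma_2$ and $\tilde{\beta}(\Sigma_2) = \Sigma^2$.
   Context: Here $SL_2(\mathbb{N})$ denotes the set of $2\times 2$ matrices with non-negative integer entries and determinant $1$. Let $\tilde{\beta}: GL_2(\mathbb{R}) \to GL_2(\mathbb{R})$ be the linear map $$\tilde{\beta}\begin{pmatrix} a_{11} & a_{12} \\ a_{21} & a_{22}\end{pmatrix} := \begin{pmatrix} 2 a_{11} + a_{21} & a_{12} - a_{11} + (a_{22} - a_{21})/2 \\ a_{21} & (a_{22} - a_{21})/2\end{pmatrix}.$$ With $R = \begin{pmatrix} 1 & 1 \\ 0 & 1\end{pmatrix}$ let $\Sigma^2$ and $\Sigma_2$ denote the following two subsets of $SL_2(\mathbb{N})$: $$\Sigma^2 = \left\{ R \cdot \begin{pmatrix} 2 b_{11} & b_{12} \\ b_{21} & b_{22}\end{pmatrix} \;\middle|\; b_{11}, b_{12}, b_{21}, b_{22} \in \mathbb{N},\ 2 b_{11} b_{22} - b_{12} b_{21} = 1 \right\},$$ $$\Sigma_2 = \left\{ \begin{pmatrix} b_{11} & b_{12} \\ b_{21} & 2 b_{22}\end{pmatrix} \cdot R \;\middle|\; b_{11}, b_{12}, b_{21}, b_{22} \in \mathbb{N},\ 2 b_{11} b_{22} - b_{12} b_{21} = 1 \right\}.$$ (Motivation: $\tilde{\beta}$ sends the incidence matrix of the apotomic projection $f$ of a pairwise well-formed substitution to the incidence matrix of its apo-syntonic projection $g$.) -}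

module Defs where

open import Data.Nat as ℕ using (ℕ)
open import Data.Integer using (+_)
open import Data.Rational using (ℚ; _+_; _-_; _*_; ½; 1ℚ; 0ℚ)
open import Data.Product using (Σ; ∃; _×_; _,_)
open import Relation.Binary.PropositionalEquality using (_≡_)

-- 2×2 matrices (a11 a12 ; a21 a22) with rational entries.
-- (The paper works in GL₂(ℝ); all matrices involved have entries in ½ℤ ⊂ ℚ.)
record M2 : Set where
  constructor mat
  field
    a11 a12 a21 a22 : ℚ
open M2 public

ι : ℕ → ℚ
ι n = (+ n) Data.Rational./ 1

two : ℚ
two = ι 2

_·_ : M2 → M2 → M2
mat a b c d · mat e f g h = mat (a * e + b * g) (a * f + b * h) (c * e + d * g) (c * f + d * h)

R : M2
R = mat 1ℚ 1ℚ 0ℚ 1ℚ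

β̃ : M2 → M2
β̃ (mat a11 a12 a21 a22) =
  mat (two * a11 + a21) (a12 - a11 + (a22 - a21) * ½)
      a21             ((a22 - a21) * ½)

InSL2ℕ : M2 → Set
InSL2ℕ A = Σ ℕ λ n11 → Σ ℕ λ n12 → Σ ℕ λ n21 → Σ ℕ λ n22 →
  (A ≡ mat (ι n11) (ι n12) (ι n21) (ι n22)) × (n11 ℕ.* n22 ≡ 1 ℕ.+ n12 ℕ.* n21)

InΣ² : M2 → Set
InΣ² A = Σ ℕ λ b11 → Σ ℕ λ b12 → Σ ℕ λ b21 → Σ ℕ λ b22 →
  (2 ℕ.* b11 ℕ.* b22 ≡ 1 ℕ.+ b12 ℕ.* b21) ×
  (A ≡ R · mat (ι (2 ℕ.* b11)) (ι b12) (ι b21) (ι b22))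

InΣ₂ : M2 → Set
InΣ₂ A = Σ ℕ λ b11 → Σ ℕ λ b12 → Σ ℕ λ b21 → Σ ℕ λ b22 →
  (2 ℕ.* b11 ℕ.* b22 ≡ 1 ℕ.+ b12 ℕ.* b21) ×
  (A ≡ mat (ι b11) (ι b12) (ι b21) (ι (2 ℕ.* b22)) · R)

-- β̃ intertwines right and left multiplication by R: β̃ ((x y ; z 2w) · R) = R · (2x y ; z w).
-- Multiplication by R preserves the determinant and non-negativity, so β̃ maps Σ₂ onto Σ²
-- and both lie in SL₂(ℕ).  Conversely, if A and β̃ A lie in SL₂(ℕ), the entries of β̃ A
-- give a₂₂ = a₂₁ + 2k and a₁₁ ≤ a₁₂ + k with k ∈ ℕ; if k ≥ 1 and a₁₁ > a₁₂ then det A ≥ 2,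
-- so in all cases a₁₁ ≤ a₁₂ and A = (a₁₁ (a₁₂ ∸ a₁₁) ; a₂₁ 2k) · R ∈ Σ₂.
module Submission where

open import Defs
open import Data.Nat as ℕ using (ℕ; zero; suc)
open import Data.Product using (Σ; _×_; _,_; uncurry)
open import Relation.Binary.PropositionalEquality

module _ where
  open import Data.Nat using (_+_; _*_; _≤_; _<_; z≤n; s≤s; _≤?_)
  open import Data.Nat.Properties
  open import Data.Nat.Tactic.RingSolver using (solve-∀)
  open import Relation.Nullary using (yes; no; contradiction)

  1+[a+b]*c≡a*c+[1+b*c] : ∀ a b c → 1 + (a + b) * c ≡ a * c + (1 + b * c)
  1+[a+b]*c≡a*c+[1+b*c] = solve-∀

  det-·R : ∀ a b c d → a * d ≡ 1 + b * c → a * (c + d) ≡ 1 + (a + b) * c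
  det-·R a b c d det = begin
    a * (c + d)         ≡⟨ *-distribˡ-+ a c d ⟩
    a * c + a * d       ≡⟨ cong (a * c +_) det ⟩
    a * c + (1 + b * c) ≡⟨ 1+[a+b]*c≡a*c+[1+b*c] a b c ⟨
    1 + (a + b) * c     ∎
    where open ≡-Reasoning

  det-·R⁻¹ : ∀ a b c d → a * (c + d) ≡ 1 + (a + b) * c → a * d ≡ 1 + b * c
  det-·R⁻¹ a b c d det = +-cancelˡ-≡ (a * c) (a * d) (1 + b * c) (begin
    a * c + a * d       ≡⟨ *-distribˡ-+ a c d ⟨
    a * (c + d)         ≡⟨ det ⟩
    1 + (a + b) * c     ≡⟨ 1+[a+b]*c≡a*c+[1+b*c] a b c ⟩
    a * c + (1 + b * c) ∎)
    where open ≡-Reasoning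

  det-R· : ∀ a b c d → a * d ≡ 1 + b * c → (a + c) * d ≡ 1 + (b + d) * c
  det-R· a b c d det = begin
    (a + c) * d         ≡⟨ *-distribʳ-+ d a c ⟩
    a * d + c * d       ≡⟨ cong (_+ c * d) det ⟩
    1 + b * c + c * d   ≡⟨ +-assoc 1 (b * c) (c * d) ⟩
    1 + (b * c + c * d) ≡⟨ cong (λ x → 1 + (b * c + x)) (*-comm c d) ⟩
    1 + (b * c + d * c) ≡⟨ cong (1 +_) (*-distribʳ-+ c b d) ⟨
    1 + (b + d) * c     ∎
    where open ≡-Reasoning

  m*[2*n]≡2*m*n : ∀ m n → m * (2 * n) ≡ 2 * m * n
  m*[2*n]≡2*m*n = solve-∀

  ≤-of-det : ∀ a b c k → a * (c + 2 * k) ≡ 1 + b * c → a ≤ b + k → a ≤ b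
  ≤-of-det a b c zero    _   a≤b+0 = ≤-trans a≤b+0 (≤-reflexive (+-identityʳ b))
  ≤-of-det a b c (suc j) det _     with a ≤? b
  ... | yes a≤b = a≤b
  ... | no  a≰b = contradiction det (>⇒≢ det>1+b*c)
    where
    b<a : b < a
    b<a = ≰⇒> a≰b
    det>1+b*c : 1 + b * c < a * (c + 2 * suc j)
    det>1+b*c = begin-strict
      1 + b * c               <⟨ n<1+n (1 + b * c) ⟩
      2 + b * c               ≡⟨ +-comm 2 (b * c) ⟩
      b * c + 2               ≤⟨ +-mono-≤ (*-monoˡ-≤ c (<⇒≤ b<a))
                                          (*-mono-≤ (≤-trans (s≤s z≤n) b<a) (*-monoʳ-≤ 2 (s≤s z≤n))) ⟩
      a * c + a * (2 * suc j) ≡⟨ *-distribˡ-+ a c (2 * suc j) ⟨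
      a * (c + 2 * suc j)     ∎
      where open ≤-Reasoning

module _ where
  open import Data.Integer as ℤ using (+_)
  import Data.Integer.Properties as ℤ
  open import Data.Rational using (_+_; _-_; _*_; ½; 1ℚ; 0ℚ; toℚᵘ)
  open import Data.Rational.Properties using (normalize-coprime; toℚᵘ-injective; toℚᵘ-homo-+; toℚᵘ-homo-*)
  open import Data.Rational.Solver using (module +-*-Solver)
  open import Data.Rational.Unnormalised as ℚᵘ using (mkℚᵘ; *≡*)
  import Data.Rational.Unnormalised.Properties as ℚᵘ
  open import Data.Nat.Coprimality using (1-coprimeTo) renaming (sym to coprime-sym)
  open +-*-Solver

  toℚᵘ-ι : ∀ n → toℚᵘ (ι n) ≡ mkℚᵘ (+ n) 0
  toℚᵘ-ι n = cong toℚᵘ (normalize-coprime (coprime-sym (1-coprimeTo n)))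

  ι-+ : ∀ m n → ι (m ℕ.+ n) ≡ ι m + ι n
  ι-+ m n = toℚᵘ-injective (begin
    toℚᵘ (ι (m ℕ.+ n))             ≡⟨ toℚᵘ-ι (m ℕ.+ n) ⟩
    mkℚᵘ (+ (m ℕ.+ n)) 0           ≈⟨ *≡* (cong (ℤ._* + 1) pos-+) ⟩
    mkℚᵘ (+ m) 0 ℚᵘ.+ mkℚᵘ (+ n) 0 ≡⟨ cong₂ ℚᵘ._+_ (toℚᵘ-ι m) (toℚᵘ-ι n) ⟨
    toℚᵘ (ι m) ℚᵘ.+ toℚᵘ (ι n)     ≈⟨ toℚᵘ-homo-+ (ι m) (ι n) ⟨
    toℚᵘ (ι m + ι n)               ∎)
    where
    open ℚᵘ.≃-Reasoning
    pos-+ : + (m ℕ.+ n) ≡ + m ℤ.* + 1 ℤ.+ + n ℤ.* + 1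
    pos-+ = trans (ℤ.pos-+ m n) (sym (cong₂ ℤ._+_ (ℤ.*-identityʳ (+ m)) (ℤ.*-identityʳ (+ n))))

  ι-* : ∀ m n → ι (m ℕ.* n) ≡ ι m * ι n
  ι-* m n = toℚᵘ-injective (begin
    toℚᵘ (ι (m ℕ.* n))             ≡⟨ toℚᵘ-ι (m ℕ.* n) ⟩
    mkℚᵘ (+ (m ℕ.* n)) 0           ≈⟨ *≡* (cong (ℤ._* + 1) (ℤ.pos-* m n)) ⟩
    mkℚᵘ (+ m) 0 ℚᵘ.* mkℚᵘ (+ n) 0 ≡⟨ cong₂ ℚᵘ._*_ (toℚᵘ-ι m) (toℚᵘ-ι n) ⟨
    toℚᵘ (ι m) ℚᵘ.* toℚᵘ (ι n)     ≈⟨ toℚᵘ-homo-* (ι m) (ι n) ⟨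
    toℚᵘ (ι m * ι n)               ∎)
    where open ℚᵘ.≃-Reasoning

  ι-injective : ∀ {m n} → ι m ≡ ι n → m ≡ n
  ι-injective {m} {n} eq =
    ℤ.+-injective (cong ℚᵘ.↥_ (trans (sym (toℚᵘ-ι m)) (trans (cong toℚᵘ eq) (toℚᵘ-ι n))))

  mat-cong : ∀ {a b c d a′ b′ c′ d′} → a ≡ a′ → b ≡ b′ → c ≡ c′ → d ≡ d′ → mat a b c d ≡ mat a′ b′ c′ d′
  mat-cong refl refl refl refl = refl

  mat·R : ∀ a b c d → mat a b c d · R ≡ mat a (a + b) c (c + d)
  mat·R a b c d = mat-cong (x*1+y*0≡x a b) (x*1+y*1≡x+y a b) (x*1+y*0≡x c d) (x*1+y*1≡x+y c d)
    where
    x*1+y*0≡x : ∀ x y → x * 1ℚ + y * 0ℚ ≡ x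
    x*1+y*0≡x = solve 2 (λ x y → x :* con 1ℚ :+ y :* con 0ℚ := x) refl
    x*1+y*1≡x+y : ∀ x y → x * 1ℚ + y * 1ℚ ≡ x + y
    x*1+y*1≡x+y = solve 2 (λ x y → x :* con 1ℚ :+ y :* con 1ℚ := x :+ y) refl

  R·mat : ∀ a b c d → R · mat a b c d ≡ mat (a + c) (b + d) c d
  R·mat a b c d = mat-cong (1*x+1*y≡x+y a c) (1*x+1*y≡x+y b d) (0*x+1*y≡y a c) (0*x+1*y≡y b d)
    where
    1*x+1*y≡x+y : ∀ x y → 1ℚ * x + 1ℚ * y ≡ x + y
    1*x+1*y≡x+y = solve 2 (λ x y → con 1ℚ :* x :+ con 1ℚ :* y := x :+ y) refl
    0*x+1*y≡y : ∀ x y → 0ℚ * x + 1ℚ * y ≡ y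
    0*x+1*y≡y = solve 2 (λ x y → con 0ℚ :* x :+ con 1ℚ :* y := y) refl

  β̃-·R : ∀ a b c d → β̃ (mat a b c (two * d) · R) ≡ R · mat (two * a) b c d
  β̃-·R a b c d = begin
    β̃ (mat a b c (two * d) · R)          ≡⟨ cong β̃ (mat·R a b c (two * d)) ⟩
    β̃ (mat a (a + b) c (c + two * d))    ≡⟨ mat-cong refl a12≡ refl a22≡ ⟩
    mat (two * a + c) (b + d) c d        ≡⟨ R·mat (two * a) b c d ⟨
    R · mat (two * a) b c d              ∎
    where
    open ≡-Reasoning
    a12≡ : a + b - a + (c + two * d - c) * ½ ≡ b + d
    a12≡ = solve 4 (λ a b c d → a :+ b :- a :+ (c :+ con two :* d :- c) :* con ½ := b :+ d) refl a b c d
    a22≡ : (c + two * d - c) * ½ ≡ d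
    a22≡ = solve 2 (λ c d → (c :+ con two :* d :- c) :* con ½ := d) refl c d

  a22-β̃ : ∀ A → a22 A ≡ a21 A + two * a22 (β̃ A)
  a22-β̃ A = solve 2 (λ x y → x := y :+ con two :* ((x :- y) :* con ½)) refl (a22 A) (a21 A)

  a12-β̃ : ∀ A → a12 A + a22 (β̃ A) ≡ a12 (β̃ A) + a11 A
  a12-β̃ A = solve 4 (λ w x y z → x :+ (z :- y) :* con ½ := x :- w :+ (z :- y) :* con ½ :+ w) refl
    (a11 A) (a12 A) (a21 A) (a22 A)

  ιmat : ℕ → ℕ → ℕ → ℕ → M2
  ιmat a b c d = mat (ι a) (ι b) (ι c) (ι d)

  ιmat·R : ∀ a b c d → ιmat a b c d · R ≡ ιmat a (a ℕ.+ b) c (c ℕ.+ d)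
  ιmat·R a b c d = trans (mat·R (ι a) (ι b) (ι c) (ι d)) (sym (mat-cong refl (ι-+ a b) refl (ι-+ c d)))

  R·ιmat : ∀ a b c d → R · ιmat a b c d ≡ ιmat (a ℕ.+ c) (b ℕ.+ d) c d
  R·ιmat a b c d = trans (R·mat (ι a) (ι b) (ι c) (ι d)) (sym (mat-cong (ι-+ a c) (ι-+ b d) refl refl))

  β̃-ιmat·R : ∀ a b c d → β̃ (ιmat a b c (2 ℕ.* d) · R) ≡ R · ιmat (2 ℕ.* a) b c d
  β̃-ιmat·R a b c d = begin
    β̃ (ιmat a b c (2 ℕ.* d) · R)               ≡⟨ cong (λ x → β̃ (mat (ι a) (ι b) (ι c) x · R)) (ι-* 2 d) ⟩
    β̃ (mat (ι a) (ι b) (ι c) (two * ι d) · R)  ≡⟨ β̃-·R (ι a) (ι b) (ι c) (ι d) ⟩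
    R · mat (two * ι a) (ι b) (ι c) (ι d)      ≡⟨ cong (λ x → R · mat x (ι b) (ι c) (ι d)) (ι-* 2 a) ⟨
    R · ιmat (2 ℕ.* a) b c d                   ∎
    where open ≡-Reasoning

  β̃-ιmat-a22 : ∀ a b c d p q r s → β̃ (ιmat a b c d) ≡ ιmat p q r s → d ≡ c ℕ.+ 2 ℕ.* s
  β̃-ιmat-a22 a b c d _ _ _ s eq = ι-injective (begin
    ι d                                 ≡⟨ a22-β̃ (ιmat a b c d) ⟩
    ι c + two * a22 (β̃ (ιmat a b c d))  ≡⟨ cong (λ B → ι c + two * a22 B) eq ⟩
    ι c + two * ι s                     ≡⟨ cong (λ x → ι c + x) (ι-* 2 s) ⟨
    ι c + ι (2 ℕ.* s)                   ≡⟨ ι-+ c (2 ℕ.* s) ⟨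
    ι (c ℕ.+ 2 ℕ.* s)                   ∎)
    where open ≡-Reasoning

  β̃-ιmat-a12 : ∀ a b c d p q r s → β̃ (ιmat a b c d) ≡ ιmat p q r s → b ℕ.+ s ≡ q ℕ.+ a
  β̃-ιmat-a12 a b c d _ q _ s eq = ι-injective (begin
    ι (b ℕ.+ s)                         ≡⟨ ι-+ b s ⟩
    ι b + ι s                           ≡⟨ cong (λ B → ι b + a22 B) eq ⟨
    ι b + a22 (β̃ (ιmat a b c d))        ≡⟨ a12-β̃ (ιmat a b c d) ⟩
    a12 (β̃ (ιmat a b c d)) + ι a        ≡⟨ cong (λ B → a12 B + ι a) eq ⟩
    ι q + ι a                           ≡⟨ ι-+ q a ⟨
    ι (q ℕ.+ a)                         ∎)
    where open ≡-Reasoning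

module _ where
  open import Data.Nat using (_+_; _*_; _∸_; _≤_)
  open import Data.Nat.Properties using (m+[n∸m]≡n; m≤n+m)

  Σ₂⊆SL₂ℕ : ∀ {A} → InΣ₂ A → InSL2ℕ A
  Σ₂⊆SL₂ℕ (b11 , b12 , b21 , b22 , det , refl) =
    b11 , b11 + b12 , b21 , b21 + 2 * b22 , ιmat·R b11 b12 b21 (2 * b22) ,
    det-·R b11 b12 b21 (2 * b22) (trans (m*[2*n]≡2*m*n b11 b22) det)

  Σ²⊆SL₂ℕ : ∀ {B} → InΣ² B → InSL2ℕ B
  Σ²⊆SL₂ℕ (b11 , b12 , b21 , b22 , det , refl) =
    2 * b11 + b21 , b12 + b22 , b21 , b22 , R·ιmat (2 * b11) b12 b21 b22 , det-R· (2 * b11) b12 b21 b22 det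

  β̃-Σ₂⊆Σ² : ∀ {A} → InΣ₂ A → InΣ² (β̃ A)
  β̃-Σ₂⊆Σ² (b11 , b12 , b21 , b22 , det , refl) = b11 , b12 , b21 , b22 , det , β̃-ιmat·R b11 b12 b21 b22

  Σ²⊆β̃-Σ₂ : ∀ {B} → InΣ² B → Σ M2 λ A → InΣ₂ A × β̃ A ≡ B
  Σ²⊆β̃-Σ₂ (b11 , b12 , b21 , b22 , det , refl) =
    ιmat b11 b12 b21 (2 * b22) · R , (b11 , b12 , b21 , b22 , det , refl) , β̃-ιmat·R b11 b12 b21 b22

  SL₂ℕ∩β̃⁻¹SL₂ℕ⊆Σ₂ : ∀ {A} → InSL2ℕ A → InSL2ℕ (β̃ A) → InΣ₂ A
  SL₂ℕ∩β̃⁻¹SL₂ℕ⊆Σ₂ (n11 , n12 , n21 , n22 , refl , det) (m11 , m12 , m21 , k , β̃A≡ , _) =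
    n11 , b12 , n21 , k , det-Σ₂ , A≡
    where
    b12 : ℕ
    b12 = n12 ∸ n11
    n22≡ : n22 ≡ n21 + 2 * k
    n22≡ = β̃-ιmat-a22 n11 n12 n21 n22 m11 m12 m21 k β̃A≡
    n11≤n12+k : n11 ≤ n12 + k
    n11≤n12+k = subst (n11 ≤_) (sym (β̃-ιmat-a12 n11 n12 n21 n22 m11 m12 m21 k β̃A≡)) (m≤n+m n11 m12)
    det′ : n11 * (n21 + 2 * k) ≡ 1 + n12 * n21
    det′ = subst (λ x → n11 * x ≡ 1 + n12 * n21) n22≡ det
    n12≡ : n11 + b12 ≡ n12
    n12≡ = m+[n∸m]≡n (≤-of-det n11 n12 n21 k det′ n11≤n12+k)
    det-Σ₂ : 2 * n11 * k ≡ 1 + b12 * n21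
    det-Σ₂ = trans (sym (m*[2*n]≡2*m*n n11 k))
      (det-·R⁻¹ n11 b12 n21 (2 * k) (subst (λ x → n11 * (n21 + 2 * k) ≡ 1 + x * n21) (sym n12≡) det′))
    A≡ : ιmat n11 n12 n21 n22 ≡ ιmat n11 b12 n21 (2 * k) · R
    A≡ = trans (cong₂ (λ x y → ιmat n11 x n21 y) (sym n12≡) n22≡) (sym (ιmat·R n11 b12 n21 (2 * k)))

lemma1 : ((A : M2) → ((InSL2ℕ A × InSL2ℕ (β̃ A)) → InΣ₂ A) × (InΣ₂ A → (InSL2ℕ A × InSL2ℕ (β̃ A))))
         × ((B : M2) → ((Σ M2 λ A → InΣ₂ A × (β̃ A ≡ B)) → InΣ² B) × (InΣ² B → (Σ M2 λ A → InΣ₂ A × (β̃ A ≡ B))))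
lemma1 =
  (λ A → uncurry SL₂ℕ∩β̃⁻¹SL₂ℕ⊆Σ₂ , λ A∈Σ₂ → Σ₂⊆SL₂ℕ A∈Σ₂ , Σ²⊆SL₂ℕ (β̃-Σ₂⊆Σ² A∈Σ₂)) ,
  (λ B → (λ { (A , A∈Σ₂ , refl) → β̃-Σ₂⊆Σ² A∈Σ₂ }) , Σ²⊆β̃-Σ₂)
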